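{- Let $\mathcal{G}$ be a cofinitary group, $r\in2^\omega$ and $(s,E)\in\mathbb{Z}_\mathcal{G}(r)$. Then there is $(t,E)\in\mathbb{Z}_\mathcal{G}(r)$ such that $(t,E)\le(s,E)$ and $|\mathcal{O}^c_s|<|\mathcal{O}^c_t|$.
   Context: A cofinitary group is a subgroup $\mathcal{G}$ of the group $S_\infty$ of permutations of $\omega$ in which every non-identity element has only finitely many fixed points. Words: $W_\mathcal{G}$ is the set of words in the alphabet $\mathcal{G}\cup\{x,x^{ -1}\}$. For a (partial) injection $s$ and $w\in W_\mathcal{G}$, $w[s]$ is obtained by replacing $x,x^{ -1}$ by $s,s^{ -1}$ and composing (rightmost letter first); $\mathrm{fix}(w[s])=\{n: w[s](n)\text{ defined and }=n\}$. A word is nice if it is $x^k$ ($k>0$) or $g_lx^{k_l}\cdots g_1x^{k_1}g_0x^{k_0}$ with $k_0>0$, $k_i\in\mathbb{Z}\setminus\{0\}$, $g_i\in\mathcal{G}\setminus\{\mathrm{id}\}$; $W^*_\mathcal{G}$ is the set of nice words. $\mathbb{Z}_\mathcal{G}$ consists of pairs $(s,E)$, $s$ a finite partial injection $\omega\to\omega$, $E$ a finite subset of $W^*_\mathcal{G}$, with $(t,F)\le(s,E)$ iff $s\subseteq t$, $E\subseteq F$ and $\mathrm{fix}(w[t])=\mathrm{fix}(w[s])$ for all $w\in E$. Orbits: for a finite partial injection $s$, $O_s(n)$ is the smallest set containing $n$ closed under $s$ and $s^{ -1}$; $\mathcal{O}_s=\{O_s(n):n<\omega\}$; $O$ is closed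 if $O\subseteq\mathrm{dom}(s)\cap\mathrm{ran}(s)$, and $\mathcal{O}^c_s$ is the set of closed orbits. $s$ is nice if every $O\in\mathcal{O}^c_s$ has $\min(O)<\min(\omega\setminus\bigcup\mathcal{O}^c_s)$. For nice $s$, order $\mathcal{O}^c_s$ by minima and let $o_s(n)=|O_n|\bmod 2$ for $n<|\mathcal{O}^c_s|$, $O_n$ the $n$-th closed orbit. For $r\in2^\omega$, nice $s$ codes $r$ if $o_s\subseteq r$. $\mathbb{Z}_\mathcal{G}(r)$ is the set of $(s,E)\in\mathbb{Z}_\mathcal{G}$ with $s$ nice and coding $r$, ordered as in $\mathbb{Z}_\mathcal{G}$. -}

module Defs where

open import Data.Nat using (ℕ; zero; suc; _≤_; _<_; _%_)
open import Data.Integer using (ℤ; +_; -[1+_]; 0ℤ)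
open import Data.Bool using (Bool; if_then_else_)
open import Data.Fin using (Fin; toℕ)
open import Data.Product using (Σ; _×_; _,_)
open import Data.Sum using (_⊎_)
open import Data.List using (List; []; _∷_; _++_; replicate; concatMap; length; lookup)
open import Data.List.Membership.Propositional using (_∈_)
open import Data.List.Relation.Unary.All using (All)
open import Data.List.Relation.Unary.Linked using (Linked)
open import Data.List.Relation.Unary.Unique.Propositional using (Unique)
open import Relation.Nullary using (¬_)
open import Relation.Binary.PropositionalEquality using (_≡_; _≢_)

record Perm : Set where
  field
    fun   : ℕ → ℕ
    inv   : ℕ → ℕ
    inv-l : ∀ n → inv (fun n) ≡ n
    inv-r : ∀ n → fun (inv n) ≡ n
open Perm public

idPerm : Perm
idPerm = record { fun = λ n → n ; inv = λ n → n
                ; inv-l = λ n → Relation.Binary.PropositionalEquality.refl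
                ; inv-r = λ n → Relation.Binary.PropositionalEquality.refl }

compPerm : Perm → Perm → Perm
compPerm g h = record
  { fun = λ n → fun g (fun h n) ; inv = λ n → inv h (inv g n)
  ; inv-l = λ n → Relation.Binary.PropositionalEquality.trans
                    (Relation.Binary.PropositionalEquality.cong (inv h) (inv-l g (fun h n))) (inv-l h n)
  ; inv-r = λ n → Relation.Binary.PropositionalEquality.trans
                    (Relation.Binary.PropositionalEquality.cong (fun g) (inv-r h (inv g n))) (inv-r g n) }

invPerm : Perm → Perm
invPerm g = record { fun = inv g ; inv = fun g ; inv-l = inv-r g ; inv-r = inv-l g }

IsId : Perm → Set
IsId g = ∀ n → fun g n ≡ n

_≗ₚ_ : Perm → Perm → Set
g ≗ₚ h = ∀ n → fun g n ≡ fun h n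

FinitelyManyFixed : Perm → Set
FinitelyManyFixed g = Σ ℕ λ N → ∀ n → N ≤ n → fun g n ≢ n

record CofinitaryGroup : Set₁ where
  field
    mem       : Perm → Set
    mem-resp  : ∀ g h → g ≗ₚ h → mem g → mem h
    mem-id    : mem idPerm
    mem-comp  : ∀ g h → mem g → mem h → mem (compPerm g h)
    mem-inv   : ∀ g → mem g → mem (invPerm g)
    cofinitary : ∀ g → mem g → ¬ IsId g → FinitelyManyFixed g
open CofinitaryGroup public

record PInj : Set where
  field
    pairs      : List (ℕ × ℕ)
    functional : ∀ a b b′ → (a , b) ∈ pairs → (a , b′) ∈ pairs → b ≡ b′
    injective  : ∀ a a′ b → (a , b) ∈ pairs → (a′ , b) ∈ pairs → a ≡ a′
open PInj public

_⊆ₛ_ : PInj → PInj → Set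
s ⊆ₛ t = ∀ p → p ∈ pairs s → p ∈ pairs t

InDom : PInj → ℕ → Set
InDom s n = Σ ℕ λ m → (n , m) ∈ pairs s

InRan : PInj → ℕ → Set
InRan s n = Σ ℕ λ m → (m , n) ∈ pairs s

data Letter : Set where
  gen : Perm → Letter
  x   : Letter
  x⁻¹ : Letter

-- a word, written left to right; evaluated rightmost letter first
Word : Set
Word = List Letter

xpow : ℤ → Word
xpow (+ n)     = replicate n x
xpow -[1+ n ]  = replicate (suc n) x⁻¹

block : Perm × ℤ → Word
block (g , k) = gen g ∷ xpow k

-- nice words: x^k (k>0), or g_l x^{k_l} ⋯ g_1 x^{k_1} g_0 x^{k_0}
-- (the list bs is [(g_l,k_l), …, (g_1,k_1)], k_0 = suc k0 > 0)
IsNice : CofinitaryGroup → Word → Set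
IsNice G w =
  (Σ ℕ λ k → w ≡ replicate (suc k) x)
  ⊎ (Σ (List (Perm × ℤ)) λ bs → Σ Perm λ g0 → Σ ℕ λ k0 →
       All (λ p → mem G (Data.Product.proj₁ p) × ¬ IsId (Data.Product.proj₁ p)
                   × Data.Product.proj₂ p ≢ 0ℤ) bs
     × mem G g0 × ¬ IsId g0
     × w ≡ concatMap block bs ++ (gen g0 ∷ replicate (suc k0) x))

Step : Letter → PInj → ℕ → ℕ → Set
Step (gen g) s k m = fun g k ≡ m
Step x       s k m = (k , m) ∈ pairs s
Step x⁻¹     s k m = (m , k) ∈ pairs s

Eval : Word → PInj → ℕ → ℕ → Set
Eval []      s n m = n ≡ m
Eval (l ∷ w) s n m = Σ ℕ λ k → Eval w s n k × Step l s k m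

Fix : Word → PInj → ℕ → Set
Fix w s n = Eval w s n n

InZ : CofinitaryGroup → PInj → List Word → Set
InZ G s E = All (IsNice G) E

Leq : PInj → List Word → PInj → List Word → Set
Leq t F s E =
  (s ⊆ₛ t) × (∀ w → w ∈ E → w ∈ F)
  × (∀ w → w ∈ E → ∀ n → (Fix w t n → Fix w s n) × (Fix w s n → Fix w t n))

data SameOrbit (s : PInj) : ℕ → ℕ → Set where
  here : ∀ {n} → SameOrbit s n n
  fwd  : ∀ {n k m} → (n , k) ∈ pairs s → SameOrbit s k m → SameOrbit s n m
  bwd  : ∀ {n k m} → (k , n) ∈ pairs s → SameOrbit s k m → SameOrbit s n m

ClosedAt : PInj → ℕ → Set
ClosedAt s n = ∀ m → SameOrbit s n m → InDom s m × InRan s m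

IsMinOrbit : PInj → ℕ → ℕ → Set
IsMinOrbit s n k = SameOrbit s n k × (∀ j → SameOrbit s n j → k ≤ j)

NiceS : PInj → Set
NiceS s = ∀ n → ClosedAt s n → Σ ℕ λ k → IsMinOrbit s n k
            × Σ ℕ λ c → (¬ ClosedAt s c × (∀ m → ¬ ClosedAt s m → c ≤ m)) × k < c

OrbitSize : PInj → ℕ → ℕ → Set
OrbitSize s n k = Σ (List ℕ) λ l → Unique l × length l ≡ k
                  × (∀ m → (m ∈ l → SameOrbit s n m) × (SameOrbit s n m → m ∈ l))

ClosedOrbitEnum : PInj → List ℕ → Set
ClosedOrbitEnum s reps =
  All (λ n → ClosedAt s n × IsMinOrbit s n n) reps
  × Linked _<_ reps
  × (∀ n → ClosedAt s n → Σ ℕ λ m → m ∈ reps × SameOrbit s n m)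

ClosedOrbitCount : PInj → ℕ → Set
ClosedOrbitCount s c = Σ (List ℕ) λ reps → ClosedOrbitEnum s reps × length reps ≡ c

bit : Bool → ℕ
bit b = if b then 1 else 0

Codes : PInj → (ℕ → Bool) → Set
Codes s r = Σ (List ℕ) λ reps → ClosedOrbitEnum s reps
            × ∀ (i : Fin (length reps)) → Σ ℕ λ k →
                OrbitSize s (lookup reps i) k × k % 2 ≡ bit (r (toℕ i))

InZr : CofinitaryGroup → (ℕ → Bool) → PInj → List Word → Set
InZr G r s E = InZ G s E × NiceS s × Codes s r

{-# OPTIONS --safe #-}
module Submission where

-- Let c be the least point outside the closed orbits of s. Its s-orbit is a finite path from a
-- point first with no s-preimage to a point last with no s-image. The extension t closes this
-- path into a cycle last → f 0 → ⋯ → f k → first through fresh points f q, placed so far out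
-- that every permutation occurring in E maps the points of s and of the chain off the chain
-- (for chain points this uses cofinitarity). Hence an evaluation of a word of E along t either
-- uses only edges of s, or enters the chain and is thrown by the next generator to a point
-- where t is undefined; and a power x^j can return to a chain point only after going round the
-- whole new cycle, which takes more than k steps. With k above the total exponent of the words
-- of E, t adds no fixed points. The length k also fixes the parity of the new closed orbit, and
-- its minimum c lies below every remaining open point, so t stays nice and codes r.

open import Defs
open import Function using (_∘_)
open import Data.Empty using (⊥-elim)
open import Data.Bool using (Bool; true; false)
open import Data.Nat using (ℕ; zero; suc; _+_; _*_; _≤_; _<_; z≤n; s≤s; _≟_; _%_)
open import Data.Nat.Properties
open import Data.Nat.ListAction using (sum)
open import Data.Nat.DivMod using ([m+kn]%n≡m%n; m<n⇒m%n≡m)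
open import Data.Nat.Tactic.RingSolver using (solve-∀)
open import Data.Integer using (ℤ; +_; -[1+_]; 0ℤ; ∣_∣)
open import Data.Fin using (Fin; toℕ) renaming (zero to fzero; suc to fsuc)
open import Data.Product using (Σ; _×_; _,_; proj₁; proj₂; swap)
open import Data.Sum using (_⊎_; inj₁; inj₂; [_,_]′) renaming (map to ⊎-map)
open import Data.List
  using (List; []; _∷_; _++_; [_]; length; map; lookup; concat; tabulate; deduplicate; upTo; replicate; concatMap)
open import Data.List.Properties using (length-++; length-map; length-upTo; ++-assoc; ++-identityʳ)
open import Data.List.Membership.Propositional using (_∈_; _∉_; find; lose)
open import Data.List.Membership.Propositional.Properties
  using (∈-map⁺; ∈-map⁻; ∈-++⁺ˡ; ∈-++⁺ʳ; ∈-++⁻; ∈-∃++; ∈-deduplicate⁺; ∈-deduplicate⁻; ∈-upTo⁺; ∈-upTo⁻;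
         ∈-concat⁺′; ∈-concat⁻′; ∈-tabulate⁺; ∈-tabulate⁻; ∈-lookup)
import Data.List.Membership.DecPropositional as DecMembership
open import Data.List.Relation.Unary.Any using (here; there; any?)
import Data.List.Relation.Unary.Any as Any
open import Data.List.Relation.Unary.Any.Properties using (lookup-index)
open import Data.List.Relation.Unary.All using (All; []; _∷_)
import Data.List.Relation.Unary.All as All
open import Data.List.Relation.Unary.All.Properties using (¬Any⇒All¬; All¬⇒¬Any)
import Data.List.Relation.Unary.All.Properties as All
open import Data.List.Relation.Unary.Linked using (Linked; []; [-]; _∷_)
open import Data.List.Relation.Unary.Unique.Propositional using (Unique; []; _∷_)
import Data.List.Relation.Unary.Unique.Propositional.Properties as Unique
open import Data.List.Relation.Unary.Unique.DecPropositional.Properties _≟_ using (deduplicate-!)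
open import Relation.Nullary using (¬_; yes; no)
open import Relation.Binary.Definitions using (tri<; tri≈; tri>)
open import Relation.Binary.PropositionalEquality
  using (_≡_; _≢_; refl; sym; trans; cong; subst; module ≡-Reasoning)

open DecMembership _≟_ using (_∈?_)

∈⇒≤sum : ∀ {v l} → v ∈ l → v ≤ sum l
∈⇒≤sum {l = a ∷ l} (here refl) = m≤m+n a (sum l)
∈⇒≤sum {l = a ∷ l} (there v∈l) = ≤-trans (∈⇒≤sum v∈l) (m≤n+m (sum l) a)

module _ {A : Set} where

  ∈-++-∷⁻ : ∀ {a b : A} us {vs} → a ∈ us ++ b ∷ vs → a ≢ b → a ∈ us ++ vs
  ∈-++-∷⁻ []       (here a≡b)  a≢b = ⊥-elim (a≢b a≡b)
  ∈-++-∷⁻ []       (there a∈)  _   = a∈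
  ∈-++-∷⁻ (u ∷ us) (here a≡u)  _   = here a≡u
  ∈-++-∷⁻ (u ∷ us) (there a∈)  a≢b = there (∈-++-∷⁻ us a∈ a≢b)

  length-++-∷ : ∀ {b : A} us {vs} → length (us ++ b ∷ vs) ≡ suc (length (us ++ vs))
  length-++-∷ []       = refl
  length-++-∷ (u ∷ us) = cong suc (length-++-∷ us)

  unique⇒length≤ : ∀ {xs ys : List A} → Unique xs → (∀ {v} → v ∈ xs → v ∈ ys) → length xs ≤ length ys
  unique⇒length≤ {[]}     _              _   = z≤n
  unique⇒length≤ {a ∷ xs} (a∉xs ∷ uniq) sub with ∈-∃++ (sub (here refl))
  ... | us , vs , refl = subst (suc (length xs) ≤_) (sym (length-++-∷ us))
          (s≤s (unique⇒length≤ uniq λ v∈xs → ∈-++-∷⁻ us (sub (there v∈xs))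
                  λ { refl → All¬⇒¬Any a∉xs v∈xs }))

Gap : List ℕ → ℕ → Set
Gap l c = c ∉ l × (∀ {m} → m < c → m ∈ l)

initial-segment-or-gap : ∀ l n → (∀ {m} → m < n → m ∈ l) ⊎ Σ ℕ (Gap l)
initial-segment-or-gap l zero = inj₁ λ ()
initial-segment-or-gap l (suc n) with initial-segment-or-gap l n
... | inj₂ gap = inj₂ gap
... | inj₁ below with n ∈? l
...   | no  n∉l = inj₂ (n , n∉l , below)
...   | yes n∈l = inj₁ λ m<1+n → [ below , (λ { refl → n∈l }) ]′ (m<1+n⇒m<n∨m≡n m<1+n)

least-∉ : ∀ l → Σ ℕ (Gap l)
least-∉ l with initial-segment-or-gap l (suc (suc (sum l)))
... | inj₂ gap   = gap
... | inj₁ below = ⊥-elim (<-irrefl refl (∈⇒≤sum (below ≤-refl)))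

module _ {A : Set} where

  lookup-∷ʳ : ∀ (xs : List A) a (i : Fin (length (xs ++ [ a ])))
    → (Σ (Fin (length xs)) λ j → toℕ i ≡ toℕ j × lookup (xs ++ [ a ]) i ≡ lookup xs j)
      ⊎ (toℕ i ≡ length xs × lookup (xs ++ [ a ]) i ≡ a)
  lookup-∷ʳ []       a fzero    = inj₂ (refl , refl)
  lookup-∷ʳ (_ ∷ xs) a fzero    = inj₁ (fzero , refl , refl)
  lookup-∷ʳ (_ ∷ xs) a (fsuc i) with lookup-∷ʳ xs a i
  ... | inj₁ (j , i≡j , eq) = inj₁ (fsuc j , cong suc i≡j , eq)
  ... | inj₂ (i≡n , eq)     = inj₂ (cong suc i≡n , eq)

linked-∷ʳ : ∀ {xs : List ℕ} {c} → Linked _<_ xs → All (_< c) xs → Linked _<_ (xs ++ [ c ])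
linked-∷ʳ []        []            = [-]
linked-∷ʳ [-]       (x<c ∷ [])    = x<c ∷ [-]
linked-∷ʳ (x<y ∷ l) (_ ∷ xs<c)   = x<y ∷ linked-∷ʳ l xs<c

bit-parity : ∀ b n → (bit b + n * 2) % 2 ≡ bit b
bit-parity b n = trans ([m+kn]%n≡m%n (bit b) n 2) (m<n⇒m%n≡m (bit<2 b))
  where
    bit<2 : ∀ b → bit b < 2
    bit<2 true  = s≤s (s≤s z≤n)
    bit<2 false = s≤s z≤n

-- Orbits

module _ {s : PInj} where

  SameOrbit-trans : ∀ {a b d} → SameOrbit s a b → SameOrbit s b d → SameOrbit s a d
  SameOrbit-trans here        q = q
  SameOrbit-trans (fwd p a~b) q = fwd p (SameOrbit-trans a~b q)
  SameOrbit-trans (bwd p a~b) q = bwd p (SameOrbit-trans a~b q)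

  SameOrbit-sym : ∀ {a b} → SameOrbit s a b → SameOrbit s b a
  SameOrbit-sym here        = here
  SameOrbit-sym (fwd p a~b) = SameOrbit-trans (SameOrbit-sym a~b) (bwd p here)
  SameOrbit-sym (bwd p a~b) = SameOrbit-trans (SameOrbit-sym a~b) (fwd p here)

  SameOrbit-elim : (P : ℕ → Set)
    → (∀ {a b} → (a , b) ∈ pairs s → P a → P b)
    → (∀ {a b} → (a , b) ∈ pairs s → P b → P a)
    → ∀ {a b} → SameOrbit s a b → P a → P b
  SameOrbit-elim P P⁺ P⁻ here        pa = pa
  SameOrbit-elim P P⁺ P⁻ (fwd p a~b) pa = SameOrbit-elim P P⁺ P⁻ a~b (P⁺ p pa)
  SameOrbit-elim P P⁺ P⁻ (bwd p a~b) pa = SameOrbit-elim P P⁺ P⁻ a~b (P⁻ p pa)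

  ClosedAt-resp : ∀ {a b} → SameOrbit s a b → ClosedAt s a → ClosedAt s b
  ClosedAt-resp a~b closed m b~m = closed m (SameOrbit-trans a~b b~m)

SameOrbit-mono : ∀ {s t} → s ⊆ₛ t → ∀ {a b} → SameOrbit s a b → SameOrbit t a b
SameOrbit-mono s⊆t here        = here
SameOrbit-mono s⊆t (fwd p a~b) = fwd (s⊆t _ p) (SameOrbit-mono s⊆t a~b)
SameOrbit-mono s⊆t (bwd p a~b) = bwd (s⊆t _ p) (SameOrbit-mono s⊆t a~b)

Initial : PInj → ℕ → Set
Initial s a = ∀ m → (m , a) ∉ pairs s

Terminal : PInj → ℕ → Set
Terminal s a = ∀ m → (a , m) ∉ pairs s

module _ {l : List (ℕ × ℕ)} where

  ∈-map-swap⁺ : ∀ {a b} → (a , b) ∈ l → (b , a) ∈ map swap l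
  ∈-map-swap⁺ = ∈-map⁺ swap

  ∈-map-swap⁻ : ∀ {a b} → (b , a) ∈ map swap l → (a , b) ∈ l
  ∈-map-swap⁻ m with ∈-map⁻ swap m
  ... | _ , ab∈l , refl = ab∈l

inverse : PInj → PInj
inverse s = record
  { pairs      = map swap (pairs s)
  ; functional = λ a b b′ p q → injective s b b′ a (∈-map-swap⁻ p) (∈-map-swap⁻ q)
  ; injective  = λ a a′ b p q → functional s b a a′ (∈-map-swap⁻ p) (∈-map-swap⁻ q)
  }

SameOrbit-inverse : ∀ {s a b} → SameOrbit s a b → SameOrbit (inverse s) a b
SameOrbit-inverse here        = here
SameOrbit-inverse (fwd p a~b) = bwd (∈-map-swap⁺ p) (SameOrbit-inverse a~b)
SameOrbit-inverse (bwd p a~b) = fwd (∈-map-swap⁺ p) (SameOrbit-inverse a~b)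

¬ClosedAt-inverse : ∀ {s c} → ¬ ClosedAt s c → ¬ ClosedAt (inverse s) c
¬ClosedAt-inverse open-c closed = open-c λ m c~m →
  let ((y , my) , (y′ , y′m)) = closed m (SameOrbit-inverse c~m)
  in (y′ , ∈-map-swap⁻ y′m) , (y , ∈-map-swap⁻ my)

-- Walks, open and closed orbits

data Walk (s : PInj) : ℕ → ℕ → ℕ → Set where
  []  : ∀ {y} → Walk s 0 y y
  _∷_ : ∀ {j y y′ z} → (y , y′) ∈ pairs s → Walk s j y′ z → Walk s (suc j) y z

OnCycle : PInj → ℕ → Set
OnCycle s y = Σ ℕ λ p → Walk s (suc p) y y

module _ {s : PInj} where

  walk-∷ʳ : ∀ {j y z z′} → Walk s j y z → (z , z′) ∈ pairs s → Walk s (suc j) y z′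
  walk-∷ʳ []      p = p ∷ []
  walk-∷ʳ (q ∷ w) p = q ∷ walk-∷ʳ w p

  walk-unsnoc : ∀ {j y z} → Walk s (suc j) y z → Σ ℕ λ z′ → Walk s j y z′ × (z′ , z) ∈ pairs s
  walk-unsnoc (p ∷ [])    = _ , [] , p
  walk-unsnoc (p ∷ q ∷ w) with walk-unsnoc (q ∷ w)
  ... | z′ , w′ , r = z′ , p ∷ w′ , r

  walk-++ : ∀ {i j x y z} → Walk s i x y → Walk s j y z → Walk s (i + j) x z
  walk-++ []      w′ = w′
  walk-++ (p ∷ w) w′ = p ∷ walk-++ w w′

  walk⇒SameOrbit : ∀ {j y z} → Walk s j y z → SameOrbit s y z
  walk⇒SameOrbit []      = here
  walk⇒SameOrbit (p ∷ w) = fwd p (walk⇒SameOrbit w)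

  OnCycle-step : ∀ {a b} → (a , b) ∈ pairs s → OnCycle s a → OnCycle s b
  OnCycle-step ab (p , ab′ ∷ w) with functional s _ _ _ ab ab′
  ... | refl = p , walk-∷ʳ w ab

  OnCycle-step⁻ : ∀ {a b} → (a , b) ∈ pairs s → OnCycle s b → OnCycle s a
  OnCycle-step⁻ ab (p , cycle) with walk-unsnoc cycle
  ... | z , w , zb with injective s _ _ _ zb ab
  ... | refl = p , ab ∷ w

  OnCycle⇒ClosedAt : ∀ {c} → OnCycle s c → ClosedAt s c
  OnCycle⇒ClosedAt c-cyc m c~m with SameOrbit-elim (OnCycle s) OnCycle-step OnCycle-step⁻ c~m c-cyc
  ... | p , cycle@(mm′ ∷ _) = (_ , mm′) , (_ , proj₂ (proj₂ (walk-unsnoc cycle)))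

  walks⇒OnCycle : ∀ {i j c y} → Walk s i c y → Walk s j c y → i < j → OnCycle s c
  walks⇒OnCycle {zero}  {suc j} [] w _ = j , w
  walks⇒OnCycle {suc i} {suc j} w w′ (s≤s i<j) with walk-unsnoc w | walk-unsnoc w′
  ... | _ , v , zy | _ , v′ , z′y with injective s _ _ _ zy z′y
  ... | refl = walks⇒OnCycle v v′ i<j


successor? : ∀ s y → (Σ ℕ λ y′ → (y , y′) ∈ pairs s) ⊎ Terminal s y
successor? s y with any? (λ p → proj₁ p ≟ y) (pairs s)
... | no none = inj₂ λ m ym∈s → none (lose ym∈s refl)
... | yes found with find found
...   | (_ , y′) , p∈s , refl = inj₁ (y′ , p∈s)

WalkToEnd : PInj → ℕ → Set
WalkToEnd s c = Σ ℕ λ j → Σ ℕ λ z → Walk s j c z × Terminal s z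

module _ (s : PInj) {c : ℕ} (open-c : ¬ ClosedAt s c) where

  private
    domain : List ℕ
    domain = map proj₁ (pairs s)

  -- A revisited point would put c on a cycle, so the walk ends before it outlasts the domain of s.
  extend-walk : ∀ fuel {j y} → Walk s j c y → (visited : List ℕ) → Unique visited
    → (∀ {v} → v ∈ visited → Σ ℕ λ i → i < j × Walk s i c v)
    → (∀ {v} → v ∈ visited → v ∈ domain)
    → length domain < fuel + length visited
    → WalkToEnd s c
  extend-walk zero _ visited uniq earlier ⊆domain bound =
    ⊥-elim (<⇒≱ bound (unique⇒length≤ uniq ⊆domain))
  extend-walk (suc fuel) {j} {y} w visited uniq earlier ⊆domain bound with successor? s y
  ... | inj₂ terminal = j , y , w , terminal
  ... | inj₁ (y′ , yy′) with y ∈? visited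
  ...   | yes y∈visited =
          let (i , i<j , w′) = earlier y∈visited
          in ⊥-elim (open-c (OnCycle⇒ClosedAt (walks⇒OnCycle w′ w i<j)))
  ...   | no y∉visited =
          extend-walk fuel (walk-∷ʳ w yy′) (y ∷ visited) (¬Any⇒All¬ visited y∉visited ∷ uniq)
            earlier′ ⊆domain′ (subst (length domain <_) (sym (+-suc fuel _)) bound)
    where
      earlier′ : ∀ {v} → v ∈ y ∷ visited → Σ ℕ λ i → i < suc j × Walk s i c v
      earlier′ (here refl) = j , ≤-refl , w
      earlier′ (there v∈) = let (i , i<j , w′) = earlier v∈ in i , m≤n⇒m≤1+n i<j , w′
      ⊆domain′ : ∀ {v} → v ∈ y ∷ visited → v ∈ domain
      ⊆domain′ (here refl) = ∈-map⁺ proj₁ yy′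
      ⊆domain′ (there v∈) = ⊆domain v∈

  walk-to-end : WalkToEnd s c
  walk-to-end = extend-walk (suc (length domain)) [] [] [] (λ ()) (λ ())
                  (<-≤-trans (n<1+n _) (m≤m+n _ 0))

walk-inverse : ∀ {s j y z} → Walk (inverse s) j y z → Walk s j z y
walk-inverse []      = []
walk-inverse (p ∷ w) = walk-∷ʳ (walk-inverse w) (∈-map-swap⁻ p)

points : ∀ {s j y z} → Walk s j y z → List ℕ
points {y = y} []      = [ y ]
points {y = y} (_ ∷ w) = y ∷ points w

module _ {s : PInj} where

  start∈points : ∀ {j y z} (w : Walk s j y z) → y ∈ points w
  start∈points []      = here refl
  start∈points (_ ∷ _) = here refl

  end∈points : ∀ {j y z} (w : Walk s j y z) → z ∈ points w
  end∈points []      = here refl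
  end∈points (_ ∷ w) = there (end∈points w)

  ∈points⇒SameOrbit : ∀ {j y z m} (w : Walk s j y z) → m ∈ points w → SameOrbit s y m
  ∈points⇒SameOrbit []      (here refl) = here
  ∈points⇒SameOrbit (_ ∷ _) (here refl) = here
  ∈points⇒SameOrbit (p ∷ w) (there m∈)  = fwd p (∈points⇒SameOrbit w m∈)

  ∈points⇒InDom : ∀ {j y z m} (w : Walk s j y z) → m ∈ points w → m ≢ z → InDom s m
  ∈points⇒InDom []      (here refl) m≢z = ⊥-elim (m≢z refl)
  ∈points⇒InDom (p ∷ _) (here refl) _   = _ , p
  ∈points⇒InDom (_ ∷ w) (there m∈)  m≢z = ∈points⇒InDom w m∈ m≢z

  ∈points⇒InRan : ∀ {j y z m} (w : Walk s j y z) → m ∈ points w → m ≢ y → InRan s m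
  ∈points⇒InRan []      (here refl) m≢y = ⊥-elim (m≢y refl)
  ∈points⇒InRan (_ ∷ _) (here refl) m≢y = ⊥-elim (m≢y refl)
  ∈points⇒InRan {m = m} (_∷_ {y′ = y′} p w) (there m∈) _ with m ≟ y′
  ... | yes refl = _ , p
  ... | no m≢y′  = ∈points⇒InRan w m∈ m≢y′

  walk⇒∈points : ∀ {i j y z m} (w : Walk s j y z) → Terminal s z → Walk s i y m → m ∈ points w
  walk⇒∈points []      _        []      = here refl
  walk⇒∈points []      terminal (p ∷ _) = ⊥-elim (terminal _ p)
  walk⇒∈points (_ ∷ _) _        []      = here refl
  walk⇒∈points (p ∷ w) terminal (q ∷ v) with functional s _ _ _ p q
  ... | refl = there (walk⇒∈points w terminal v)

  SameOrbit-initial⇒walk : ∀ {a m} → Initial s a → SameOrbit s a m → Σ ℕ λ i → Walk s i a m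
  SameOrbit-initial⇒walk {a} initial a~m = SameOrbit-elim (λ m → Σ ℕ λ i → Walk s i a m) forward backward a~m (0 , [])
    where
      forward : ∀ {x y} → (x , y) ∈ pairs s → Σ ℕ (λ i → Walk s i a x) → Σ ℕ λ i → Walk s i a y
      forward xy (i , w) = suc i , walk-∷ʳ w xy
      backward : ∀ {x y} → (x , y) ∈ pairs s → Σ ℕ (λ i → Walk s i a y) → Σ ℕ λ i → Walk s i a x
      backward xy (zero , []) = ⊥-elim (initial _ xy)
      backward xy (suc i , w) with walk-unsnoc w
      ... | _ , w′ , zy with injective s _ _ _ zy xy
      ... | refl = i , w′

record OpenOrbit (s : PInj) (c : ℕ) : Set where
  field
    orbit          : List ℕ
    orbit-unique   : Unique orbit
    ∈orbit⇒SameOrbit : ∀ {m} → m ∈ orbit → SameOrbit s c m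
    SameOrbit⇒∈orbit : ∀ {m} → SameOrbit s c m → m ∈ orbit
    first last     : ℕ
    first∈orbit    : first ∈ orbit
    last∈orbit     : last ∈ orbit
    first-initial  : Initial s first
    last-terminal  : Terminal s last
    ∈orbit⇒InDom   : ∀ {m} → m ∈ orbit → m ≢ last → InDom s m
    ∈orbit⇒InRan   : ∀ {m} → m ∈ orbit → m ≢ first → InRan s m

module _ {s : PInj} {c : ℕ} where

  open-orbit-of-walks : ∀ {j₁ a₀ j₂ aₘ} → Walk (inverse s) j₁ c a₀ → Terminal (inverse s) a₀
    → Walk s j₂ c aₘ → Terminal s aₘ → OpenOrbit s c
  open-orbit-of-walks {a₀ = a₀} {aₘ = aₘ} w₁ a₀-terminal w₂ aₘ-terminal = record
    { orbit            = deduplicate _≟_ (points w)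
    ; orbit-unique     = deduplicate-! (points w)
    ; ∈orbit⇒SameOrbit = λ m∈ → SameOrbit-trans c~a₀ (∈points⇒SameOrbit w (∈points m∈))
    ; SameOrbit⇒∈orbit = λ c~m → ∈-deduplicate⁺ _≟_ (walk⇒∈points w aₘ-terminal
                           (proj₂ (SameOrbit-initial⇒walk a₀-initial (SameOrbit-trans (SameOrbit-sym c~a₀) c~m))))
    ; first            = a₀
    ; last             = aₘ
    ; first∈orbit      = ∈-deduplicate⁺ _≟_ (start∈points w)
    ; last∈orbit       = ∈-deduplicate⁺ _≟_ (end∈points w)
    ; first-initial    = a₀-initial
    ; last-terminal    = aₘ-terminal
    ; ∈orbit⇒InDom     = λ m∈ → ∈points⇒InDom w (∈points m∈)
    ; ∈orbit⇒InRan     = λ m∈ → ∈points⇒InRan w (∈points m∈)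
    }
    where
      w : Walk s _ a₀ aₘ
      w = walk-++ (walk-inverse w₁) w₂
      c~a₀ : SameOrbit s c a₀
      c~a₀ = SameOrbit-sym (walk⇒SameOrbit (walk-inverse w₁))
      a₀-initial : Initial s a₀
      a₀-initial m p = a₀-terminal m (∈-map-swap⁺ p)
      ∈points : ∀ {m} → m ∈ deduplicate _≟_ (points w) → m ∈ points w
      ∈points = ∈-deduplicate⁻ _≟_ (points w)

  open-orbit : ¬ ClosedAt s c → OpenOrbit s c
  open-orbit open-c with walk-to-end (inverse s) (¬ClosedAt-inverse open-c) | walk-to-end s open-c
  ... | _ , _ , w₁ , a₀-terminal | _ , _ , w₂ , aₘ-terminal = open-orbit-of-walks w₁ a₀-terminal w₂ aₘ-terminal

ClosedPoints : PInj → List ℕ → Set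
ClosedPoints s l = ∀ {m} → (m ∈ l → ClosedAt s m) × (ClosedAt s m → m ∈ l)

LeastOpen : PInj → ℕ → Set
LeastOpen s c = ¬ ClosedAt s c × (∀ {m} → m < c → ClosedAt s m)

least-open : ∀ {s l} → ClosedPoints s l → Σ ℕ (LeastOpen s)
least-open {l = l} closed-points with least-∉ l
... | c , c∉l , below = c , (λ closed → c∉l (proj₂ closed-points closed)) , λ m<c → proj₁ closed-points (below m<c)

LeastOpen⇒≤ : ∀ {s c m} → LeastOpen s c → ¬ ClosedAt s m → c ≤ m
LeastOpen⇒≤ (_ , below) open-m = ≮⇒≥ λ m<c → open-m (below m<c)

LeastOpen⇒orbit-min : ∀ {s c} → LeastOpen s c → ∀ {j} → SameOrbit s c j → c ≤ j
LeastOpen⇒orbit-min c-least c~j =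
  LeastOpen⇒≤ c-least λ closed-j → proj₁ c-least (ClosedAt-resp (SameOrbit-sym c~j) closed-j)

Codes⇒ClosedPoints : ∀ {s r} → Codes s r → Σ (List ℕ) (ClosedPoints s)
Codes⇒ClosedPoints {s} (reps , (reps-ok , _ , complete) , sizes) = concat (tabulate orbit-of) , ⇒closed , ⇒∈
  where
    orbit-of : Fin (length reps) → List ℕ
    orbit-of i = proj₁ (proj₁ (proj₂ (sizes i)))
    orbit-of-ok : ∀ i {m} → (m ∈ orbit-of i → SameOrbit s (lookup reps i) m) × (SameOrbit s (lookup reps i) m → m ∈ orbit-of i)
    orbit-of-ok i {m} = proj₂ (proj₂ (proj₂ (proj₁ (proj₂ (sizes i))))) m
    ⇒closed : ∀ {m} → m ∈ concat (tabulate orbit-of) → ClosedAt s m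
    ⇒closed m∈ with ∈-concat⁻′ (tabulate orbit-of) m∈
    ... | _ , m∈xs , xs∈ with ∈-tabulate⁻ xs∈
    ...   | i , refl = ClosedAt-resp (proj₁ (orbit-of-ok i) m∈xs) (proj₁ (All.lookup reps-ok (∈-lookup i)))
    ⇒∈ : ∀ {m} → ClosedAt s m → m ∈ concat (tabulate orbit-of)
    ⇒∈ {m} closed with complete m closed
    ... | rep , rep∈ , m~rep =
          ∈-concat⁺′ (proj₂ (orbit-of-ok (Any.index rep∈))
                       (subst (λ v → SameOrbit s v m) (lookup-index rep∈) (SameOrbit-sym m~rep)))
                     (∈-tabulate⁺ (Any.index rep∈))

NiceS⇒rep<open : ∀ {s n c} → NiceS s → ClosedAt s n → IsMinOrbit s n n → ¬ ClosedAt s c → n < c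
NiceS⇒rep<open s-nice closed (_ , n-min) open-c with s-nice _ closed
... | k , (n~k , _) , _ , (_ , c′-least) , k<c′ = ≤-<-trans (n-min _ n~k) (<-≤-trans k<c′ (c′-least _ open-c))

-- Evaluating words

module _ {P : PInj} where

  Eval-++⁻ : ∀ (u : Word) {v n m} → Eval (u ++ v) P n m → Σ ℕ λ k → Eval v P n k × Eval u P k m
  Eval-++⁻ []      ev             = _ , ev , refl
  Eval-++⁻ (_ ∷ u) (k , ev , st) with Eval-++⁻ u ev
  ... | k′ , ev-v , ev-u = k′ , ev-v , (k , ev-u , st)

  Eval-++⁺ : ∀ (u : Word) {v n k m} → Eval v P n k → Eval u P k m → Eval (u ++ v) P n m
  Eval-++⁺ []      ev-v refl             = ev-v
  Eval-++⁺ (_ ∷ u) ev-v (k , ev-u , st) = k , Eval-++⁺ u ev-v ev-u , st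

  Eval-xʲ⇒Walk : ∀ j {y z} → Eval (replicate j x) P y z → Walk P j y z
  Eval-xʲ⇒Walk zero    refl          = []
  Eval-xʲ⇒Walk (suc j) (_ , ev , p) = walk-∷ʳ (Eval-xʲ⇒Walk j ev) p

  Walk⇒Eval-xʲ : ∀ {j y z} → Walk P j y z → Eval (replicate j x) P y z
  Walk⇒Eval-xʲ {zero}  []  = refl
  Walk⇒Eval-xʲ {suc j} w with walk-unsnoc w
  ... | _ , w′ , p = _ , Walk⇒Eval-xʲ w′ , p

  Eval-x⁻ʲ⇒Walk : ∀ j {y z} → Eval (replicate j x⁻¹) P y z → Walk P j z y
  Eval-x⁻ʲ⇒Walk zero    refl          = []
  Eval-x⁻ʲ⇒Walk (suc j) (_ , ev , p) = p ∷ Eval-x⁻ʲ⇒Walk j ev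

  Walk⇒Eval-x⁻ʲ : ∀ {j y z} → Walk P j z y → Eval (replicate j x⁻¹) P y z
  Walk⇒Eval-x⁻ʲ []      = refl
  Walk⇒Eval-x⁻ʲ (p ∷ w) = _ , Walk⇒Eval-x⁻ʲ w , p

XWalk : PInj → ℤ → ℕ → ℕ → Set
XWalk P (+ j)     v u = Walk P j v u
XWalk P -[1+ j ]  v u = Walk P (suc j) u v

module _ {P : PInj} where

  Eval-xpow⇒XWalk : ∀ e {v u} → Eval (xpow e) P v u → XWalk P e v u
  Eval-xpow⇒XWalk (+ j)    = Eval-xʲ⇒Walk j
  Eval-xpow⇒XWalk -[1+ j ] = Eval-x⁻ʲ⇒Walk (suc j)

  XWalk⇒Eval-xpow : ∀ e {v u} → XWalk P e v u → Eval (xpow e) P v u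
  XWalk⇒Eval-xpow (+ j)    = Walk⇒Eval-xʲ
  XWalk⇒Eval-xpow -[1+ j ] = Walk⇒Eval-x⁻ʲ

Eval-mono : ∀ {s t} → s ⊆ₛ t → ∀ (w : Word) {n m} → Eval w s n m → Eval w t n m
Eval-mono s⊆t []          ev            = ev
Eval-mono s⊆t (gen g ∷ w) (k , ev , st) = k , Eval-mono s⊆t w ev , st
Eval-mono s⊆t (x ∷ w)     (k , ev , st) = k , Eval-mono s⊆t w ev , s⊆t _ st
Eval-mono s⊆t (x⁻¹ ∷ w)   (k , ev , st) = k , Eval-mono s⊆t w ev , s⊆t _ st

NiceBlock : CofinitaryGroup → Perm × ℤ → Set
NiceBlock G b = mem G (proj₁ b) × ¬ IsId (proj₁ b) × proj₂ b ≢ 0ℤ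

module _ (G : CofinitaryGroup) where

  nice-perms : ∀ {w} → IsNice G w → List Perm
  nice-perms (inj₁ _)              = []
  nice-perms (inj₂ (bs , g₀ , _)) = g₀ ∷ map proj₁ bs

  nice-weight : ∀ {w} → IsNice G w → ℕ
  nice-weight (inj₁ (j , _))            = suc j
  nice-weight (inj₂ (bs , _ , k₀ , _)) = suc k₀ + sum (map (λ b → ∣ proj₂ b ∣) bs)

  nice-perms-cofinitary : ∀ {w} (p : IsNice G w) → All FinitelyManyFixed (nice-perms p)
  nice-perms-cofinitary (inj₁ _) = []
  nice-perms-cofinitary (inj₂ (bs , g₀ , _ , bs-ok , g₀∈G , g₀≢id , _)) =
    cofinitary G g₀ g₀∈G g₀≢id ∷ blocks-cofinitary bs-ok
    where
      blocks-cofinitary : ∀ {bs} → All (NiceBlock G) bs → All FinitelyManyFixed (map proj₁ bs)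
      blocks-cofinitary []                       = []
      blocks-cofinitary ((g∈G , g≢id , _) ∷ ok) = cofinitary G _ g∈G g≢id ∷ blocks-cofinitary ok

  words-perms : ∀ {E} → All (IsNice G) E → List Perm
  words-perms []       = []
  words-perms (p ∷ ps) = nice-perms p ++ words-perms ps

  words-weight : ∀ {E} → All (IsNice G) E → ℕ
  words-weight []       = 0
  words-weight (p ∷ ps) = nice-weight p + words-weight ps

  words-perms-cofinitary : ∀ {E} (ps : All (IsNice G) E) → All FinitelyManyFixed (words-perms ps)
  words-perms-cofinitary []       = []
  words-perms-cofinitary (p ∷ ps) = All.++⁺ (nice-perms-cofinitary p) (words-perms-cofinitary ps)

  word-bounds : ∀ {E w} (ps : All (IsNice G) E) → w ∈ E → Σ (IsNice G w) λ p
    → (∀ {g} → g ∈ nice-perms p → g ∈ words-perms ps) × nice-weight p ≤ words-weight ps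
  word-bounds (p ∷ ps) (here refl) = p , ∈-++⁺ˡ , m≤m+n _ _
  word-bounds (p ∷ ps) (there w∈)  =
    let (p′ , ⊆perms , ≤weight) = word-bounds ps w∈
    in p′ , ∈-++⁺ʳ (nice-perms p) ∘ ⊆perms , ≤-trans ≤weight (m≤n+m _ (nice-weight p))

common-fixed-bound : ∀ {gs} → All FinitelyManyFixed gs
  → Σ ℕ λ N → ∀ {g n} → g ∈ gs → N ≤ n → fun g n ≢ n
common-fixed-bound []               = 0 , λ ()
common-fixed-bound ((N , no-fix) ∷ hs) with common-fixed-bound hs
... | M , no-fixᴹ = N + M , λ where
  (here refl) N+M≤n → no-fix _ (≤-trans (m≤m+n N M) N+M≤n)
  (there g∈)  N+M≤n → no-fixᴹ g∈ (≤-trans (m≤n+m M N) N+M≤n)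

-- Fresh points

module FreshChain (gs : List Perm) (N : ℕ) (no-fix : ∀ {g n} → g ∈ gs → N ≤ n → fun g n ≢ n) (B : ℕ) where

  Σfun : ℕ → ℕ
  Σfun v = sum (map (λ g → fun g v) gs)

  Σinv : ℕ → ℕ
  Σinv v = sum (map (λ g → inv g v) gs)

  Σbelow : (ℕ → ℕ) → ℕ → ℕ
  Σbelow F n = sum (map F (upTo n))

  ≤Σbelow : ∀ F {y n} → y < n → F y ≤ Σbelow F n
  ≤Σbelow F y<n = ∈⇒≤sum (∈-map⁺ F (∈-upTo⁺ y<n))

  fun≤Σfun : ∀ {g} v → g ∈ gs → fun g v ≤ Σfun v
  fun≤Σfun v g∈ = ∈⇒≤sum (∈-map⁺ (λ g → fun g v) g∈)

  inv≤Σinv : ∀ {g} v → g ∈ gs → inv g v ≤ Σinv v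
  inv≤Σinv v g∈ = ∈⇒≤sum (∈-map⁺ (λ g → inv g v) g∈)

  -- fresh M exceeds every preimage of 0 … M, so no g ∈ gs maps it to a point ≤ M.
  fresh : ℕ → ℕ
  fresh M = suc (M + N + Σbelow Σinv (suc M))

  <fresh : ∀ M → M < fresh M
  <fresh M = s≤s (≤-trans (m≤m+n M N) (m≤m+n _ _))

  N≤fresh : ∀ M → N ≤ fresh M
  N≤fresh M = m≤n⇒m≤1+n (≤-trans (m≤n+m N M) (m≤m+n _ _))

  <fun-fresh : ∀ M {g} → g ∈ gs → M < fun g (fresh M)
  <fun-fresh M {g} g∈ = ≰⇒> λ g≤M → <-irrefl refl (begin-strict
    fresh M                        ≡⟨ inv-l g (fresh M) ⟨
    inv g (fun g (fresh M))        ≤⟨ inv≤Σinv _ g∈ ⟩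
    Σinv (fun g (fresh M))         ≤⟨ ≤Σbelow Σinv (s≤s g≤M) ⟩
    Σbelow Σinv (suc M)            <⟨ s≤s (m≤n+m _ (M + N)) ⟩
    fresh M                        ∎)
    where open ≤-Reasoning

  level : ℕ → ℕ
  level zero    = B + Σbelow Σfun B
  level (suc j) = fresh (level j) + Σfun (fresh (level j))

  f : ℕ → ℕ
  f j = fresh (level j)

  level<f : ∀ j → level j < f j
  level<f j = <fresh (level j)

  f≤level : ∀ j → f j ≤ level (suc j)
  f≤level j = m≤m+n _ _

  level-mono : ∀ {i j} → i ≤ j → level i ≤ level j
  level-mono {j = zero}  z≤n  = ≤-refl
  level-mono {i} {suc j} i≤1+j with m≤n⇒m<n∨m≡n i≤1+j
  ... | inj₂ refl  = ≤-refl
  ... | inj₁ i<1+j = ≤-trans (level-mono (≤-pred i<1+j)) (<⇒≤ (<-≤-trans (level<f j) (f≤level j)))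

  f-mono : ∀ {p q} → p < q → f p < f q
  f-mono {p} {q} p<q = ≤-<-trans (≤-trans (f≤level p) (level-mono p<q)) (level<f q)

  B≤level : ∀ q → B ≤ level q
  B≤level q = ≤-trans (m≤m+n B _) (level-mono (z≤n {q}))

  B≤f : ∀ q → B ≤ f q
  B≤f q = <⇒≤ (≤-<-trans (B≤level q) (level<f q))

  fun<f : ∀ {g y} q → g ∈ gs → y < B → fun g y < f q
  fun<f {g} {y} q g∈ y<B = ≤-<-trans (begin
    fun g y        ≤⟨ fun≤Σfun y g∈ ⟩
    Σfun y         ≤⟨ ≤Σbelow Σfun y<B ⟩
    Σbelow Σfun B  ≤⟨ m≤n+m _ B ⟩
    level 0        ≤⟨ level-mono (z≤n {q}) ⟩
    level q        ∎) (level<f q)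
    where open ≤-Reasoning

  B≤fun-f : ∀ {g} q → g ∈ gs → B ≤ fun g (f q)
  B≤fun-f q g∈ = <⇒≤ (≤-<-trans (B≤level q) (<fun-fresh (level q) g∈))

  fun-f≢f : ∀ {g} q p → g ∈ gs → fun g (f q) ≢ f p
  fun-f≢f {g} q p g∈ eq with <-cmp q p
  ... | tri< q<p _ _ = <-irrefl eq (≤-<-trans (≤-trans (fun≤Σfun _ g∈) (≤-trans (m≤n+m _ _) (level-mono q<p))) (level<f p))
  ... | tri≈ _ refl _ = no-fix g∈ (N≤fresh (level q)) eq
  ... | tri> _ _ p<q = <-irrefl (sym eq) (≤-<-trans (≤-trans (f≤level p) (level-mono p<q)) (<fun-fresh (level q) g∈))

-- Closing the least open orbit

module ClosingChain
  {s : PInj} {c : ℕ} (O : OpenOrbit s c) (B : ℕ)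
  (s<B : ∀ {a b} → (a , b) ∈ pairs s → a < B × b < B) (c<B : c < B)
  (f : ℕ → ℕ) (f-mono : ∀ {p q} → p < q → f p < f q) (B≤f : ∀ q → B ≤ f q)
  (k : ℕ) where

  open OpenOrbit O

  K : ℕ
  K = suc k

  f-injective : ∀ {p q} → f p ≡ f q → p ≡ q
  f-injective {p} {q} fp≡fq with <-cmp p q
  ... | tri< p<q _ _ = ⊥-elim (<-irrefl fp≡fq (f-mono p<q))
  ... | tri≈ _ p≡q _ = p≡q
  ... | tri> _ _ q<p = ⊥-elim (<-irrefl (sym fp≡fq) (f-mono q<p))

  <B⇒≢f : ∀ {y} q → y < B → y ≢ f q
  <B⇒≢f q y<B refl = <⇒≱ y<B (B≤f q)

  SameOrbit⇒<B : ∀ {m} → SameOrbit s c m → m < B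
  SameOrbit⇒<B c~m = SameOrbit-elim (_< B) (λ p _ → proj₂ (s<B p)) (λ p _ → proj₁ (s<B p)) c~m c<B

  ∈orbit⇒<B : ∀ {m} → m ∈ orbit → m < B
  ∈orbit⇒<B m∈ = SameOrbit⇒<B (∈orbit⇒SameOrbit m∈)

  New : ℕ → Set
  New y = Σ ℕ λ q → q < K × y ≡ f q

  New⇒B≤ : ∀ {y} → New y → B ≤ y
  New⇒B≤ (q , _ , refl) = B≤f q

  <B⇒¬New : ∀ {y} → y < B → ¬ New y
  <B⇒¬New y<B new = <⇒≱ y<B (New⇒B≤ new)

  s-edge⇒¬New : ∀ {a b} → (a , b) ∈ pairs s → ¬ New a × ¬ New b
  s-edge⇒¬New p = <B⇒¬New (proj₁ (s<B p)) , <B⇒¬New (proj₂ (s<B p))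

  New? : ∀ y → New y ⊎ ¬ New y
  New? y with any? (λ q → y ≟ f q) (upTo K)
  ... | yes found with find found
  ...   | q , q∈ , y≡fq = inj₁ (q , ∈-upTo⁻ q∈ , y≡fq)
  New? y | no none = inj₂ λ (q , q<K , y≡fq) → none (lose (∈-upTo⁺ q<K) y≡fq)

  data NewEdge (a b : ℕ) : Set where
    enter : a ≡ last → b ≡ f 0 → NewEdge a b
    leave : a ≡ f k → b ≡ first → NewEdge a b
    along : ∀ q → q < k → a ≡ f q → b ≡ f (suc q) → NewEdge a b

  newEdges : List (ℕ × ℕ)
  newEdges = (last , f 0) ∷ (f k , first) ∷ map (λ q → f q , f (suc q)) (upTo k)

  ∈newEdges⇒NewEdge : ∀ {a b} → (a , b) ∈ newEdges → NewEdge a b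
  ∈newEdges⇒NewEdge (here refl)         = enter refl refl
  ∈newEdges⇒NewEdge (there (here refl)) = leave refl refl
  ∈newEdges⇒NewEdge (there (there p))   with ∈-map⁻ _ p
  ... | q , q∈ , refl = along q (∈-upTo⁻ q∈) refl refl

  last<B : last < B
  last<B = ∈orbit⇒<B last∈orbit

  first<B : first < B
  first<B = ∈orbit⇒<B first∈orbit

  NewEdge-functional : ∀ {a b b′} → NewEdge a b → NewEdge a b′ → b ≡ b′
  NewEdge-functional (enter _ refl)       (enter _ refl)      = refl
  NewEdge-functional (enter refl _)       (leave a≡ _)        = ⊥-elim (<B⇒≢f k last<B a≡)
  NewEdge-functional (enter refl _)       (along q _ a≡ _)    = ⊥-elim (<B⇒≢f q last<B a≡)
  NewEdge-functional (leave a≡ _)         (enter refl _)      = ⊥-elim (<B⇒≢f k last<B a≡)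
  NewEdge-functional (leave _ refl)       (leave _ refl)      = refl
  NewEdge-functional (leave refl _)       (along q q<k a≡ _)  = ⊥-elim (<-irrefl (sym (f-injective a≡)) q<k)
  NewEdge-functional (along q _ a≡ _)     (enter refl _)      = ⊥-elim (<B⇒≢f q last<B a≡)
  NewEdge-functional (along q q<k a≡ _)   (leave refl _)      = ⊥-elim (<-irrefl (sym (f-injective a≡)) q<k)
  NewEdge-functional (along _ _ refl refl) (along _ _ a≡ refl) rewrite f-injective a≡ = refl

  NewEdge-injective : ∀ {a a′ b} → NewEdge a b → NewEdge a′ b → a ≡ a′
  NewEdge-injective (enter refl _)        (enter refl _)       = refl
  NewEdge-injective (enter _ refl)        (leave _ b≡)         = ⊥-elim (<B⇒≢f 0 first<B (sym b≡))
  NewEdge-injective (enter _ refl)        (along q _ _ b≡)     with f-injective b≡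
  ... | ()
  NewEdge-injective (leave _ b≡)          (enter _ refl)       = ⊥-elim (<B⇒≢f 0 first<B (sym b≡))
  NewEdge-injective (leave refl _)        (leave refl _)       = refl
  NewEdge-injective (leave _ refl)        (along q _ _ b≡)     = ⊥-elim (<B⇒≢f (suc q) first<B b≡)
  NewEdge-injective (along q _ _ b≡)      (enter _ refl)       with f-injective b≡
  ... | ()
  NewEdge-injective (along q _ _ refl)    (leave _ b≡)         = ⊥-elim (<B⇒≢f (suc q) first<B (sym b≡))
  NewEdge-injective (along _ _ refl refl) (along _ _ refl b≡)  rewrite suc-injective (f-injective b≡) = refl

  s-edge-source-¬NewEdge : ∀ {a b b′} → (a , b) ∈ pairs s → ¬ NewEdge a b′
  s-edge-source-¬NewEdge p (enter refl _)     = last-terminal _ p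
  s-edge-source-¬NewEdge p (leave refl _)     = <B⇒≢f k (proj₁ (s<B p)) refl
  s-edge-source-¬NewEdge p (along q _ refl _) = <B⇒≢f q (proj₁ (s<B p)) refl

  s-edge-target-¬NewEdge : ∀ {a a′ b} → (a , b) ∈ pairs s → ¬ NewEdge a′ b
  s-edge-target-¬NewEdge p (enter _ refl)     = <B⇒≢f 0 (proj₂ (s<B p)) refl
  s-edge-target-¬NewEdge p (leave _ refl)     = first-initial _ p
  s-edge-target-¬NewEdge p (along q _ _ refl) = <B⇒≢f (suc q) (proj₂ (s<B p)) refl

  data Edge (a b : ℕ) : Set where
    old : (a , b) ∈ pairs s → Edge a b
    new : NewEdge a b → Edge a b

  ∈t⇒Edge : ∀ {a b} → (a , b) ∈ pairs s ++ newEdges → Edge a b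
  ∈t⇒Edge p with ∈-++⁻ (pairs s) p
  ... | inj₁ p∈s   = old p∈s
  ... | inj₂ p∈new = new (∈newEdges⇒NewEdge p∈new)

  t : PInj
  t = record { pairs = pairs s ++ newEdges ; functional = t-functional ; injective = t-injective }
    where
      t-functional : ∀ a b b′ → (a , b) ∈ pairs s ++ newEdges → (a , b′) ∈ pairs s ++ newEdges → b ≡ b′
      t-functional _ _ _ p q with ∈t⇒Edge p | ∈t⇒Edge q
      ... | old p′ | old q′ = functional s _ _ _ p′ q′
      ... | old p′ | new e  = ⊥-elim (s-edge-source-¬NewEdge p′ e)
      ... | new e  | old q′ = ⊥-elim (s-edge-source-¬NewEdge q′ e)
      ... | new e  | new e′ = NewEdge-functional e e′
      t-injective : ∀ a a′ b → (a , b) ∈ pairs s ++ newEdges → (a′ , b) ∈ pairs s ++ newEdges → a ≡ a′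
      t-injective _ _ _ p q with ∈t⇒Edge p | ∈t⇒Edge q
      ... | old p′ | old q′ = injective s _ _ _ p′ q′
      ... | old p′ | new e  = ⊥-elim (s-edge-target-¬NewEdge p′ e)
      ... | new e  | old q′ = ⊥-elim (s-edge-target-¬NewEdge q′ e)
      ... | new e  | new e′ = NewEdge-injective e e′

  s⊆t : s ⊆ₛ t
  s⊆t _ = ∈-++⁺ˡ

  enter∈t : (last , f 0) ∈ pairs t
  enter∈t = ∈-++⁺ʳ (pairs s) (here refl)

  leave∈t : (f k , first) ∈ pairs t
  leave∈t = ∈-++⁺ʳ (pairs s) (there (here refl))

  along∈t : ∀ {q} → q < k → (f q , f (suc q)) ∈ pairs t
  along∈t q<k = ∈-++⁺ʳ (pairs s) (there (there (∈-map⁺ _ (∈-upTo⁺ q<k))))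

  cycle : List ℕ
  cycle = orbit ++ map f (upTo K)

  ∈cycle⁻ : ∀ {m} → m ∈ cycle → m ∈ orbit ⊎ New m
  ∈cycle⁻ m∈ with ∈-++⁻ orbit m∈
  ... | inj₁ m∈orbit = inj₁ m∈orbit
  ... | inj₂ m∈new with ∈-map⁻ f m∈new
  ...   | q , q∈ , refl = inj₂ (q , ∈-upTo⁻ q∈ , refl)

  orbit⊆cycle : ∀ {m} → m ∈ orbit → m ∈ cycle
  orbit⊆cycle = ∈-++⁺ˡ

  New⇒∈cycle : ∀ {m} → New m → m ∈ cycle
  New⇒∈cycle (q , q<K , refl) = ∈-++⁺ʳ orbit (∈-map⁺ f (∈-upTo⁺ q<K))

  cycle-unique : Unique cycle
  cycle-unique = Unique.++⁺ orbit-unique (Unique.map⁺ f-injective (Unique.upTo⁺ K))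
    λ (m∈orbit , m∈new) → <B⇒¬New (∈orbit⇒<B m∈orbit) (∈cycle⁻-new m∈new)
    where
      ∈cycle⁻-new : ∀ {m} → m ∈ map f (upTo K) → New m
      ∈cycle⁻-new m∈ with ∈-map⁻ f m∈
      ... | q , q∈ , refl = q , ∈-upTo⁻ q∈ , refl

  NewEdge⇒∈cycle : ∀ {a b} → NewEdge a b → a ∈ cycle × b ∈ cycle
  NewEdge⇒∈cycle (enter refl refl)      = orbit⊆cycle last∈orbit , New⇒∈cycle (0 , s≤s z≤n , refl)
  NewEdge⇒∈cycle (leave refl refl)      = New⇒∈cycle (k , ≤-refl , refl) , orbit⊆cycle first∈orbit
  NewEdge⇒∈cycle (along q q<k refl refl) =
    New⇒∈cycle (q , m≤n⇒m≤1+n q<k , refl) , New⇒∈cycle (suc q , s≤s q<k , refl)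

  s-edge-∈cycle⁺ : ∀ {a b} → (a , b) ∈ pairs s → a ∈ cycle → b ∈ cycle
  s-edge-∈cycle⁺ p a∈ with ∈cycle⁻ a∈
  ... | inj₁ a∈orbit = orbit⊆cycle (SameOrbit⇒∈orbit (SameOrbit-trans (∈orbit⇒SameOrbit a∈orbit) (fwd p here)))
  ... | inj₂ a-new   = ⊥-elim (proj₁ (s-edge⇒¬New p) a-new)

  s-edge-∈cycle⁻ : ∀ {a b} → (a , b) ∈ pairs s → b ∈ cycle → a ∈ cycle
  s-edge-∈cycle⁻ p b∈ with ∈cycle⁻ b∈
  ... | inj₁ b∈orbit = orbit⊆cycle (SameOrbit⇒∈orbit (SameOrbit-trans (∈orbit⇒SameOrbit b∈orbit) (bwd p here)))
  ... | inj₂ b-new   = ⊥-elim (proj₂ (s-edge⇒¬New p) b-new)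

  SameOrbit-t-∈cycle : ∀ {a m} → SameOrbit t a m → a ∈ cycle → m ∈ cycle
  SameOrbit-t-∈cycle = SameOrbit-elim (_∈ cycle) forward backward
    where
      forward : ∀ {a b} → (a , b) ∈ pairs t → a ∈ cycle → b ∈ cycle
      forward p a∈ with ∈t⇒Edge p
      ... | old p′ = s-edge-∈cycle⁺ p′ a∈
      ... | new e  = proj₂ (NewEdge⇒∈cycle e)
      backward : ∀ {a b} → (a , b) ∈ pairs t → b ∈ cycle → a ∈ cycle
      backward p b∈ with ∈t⇒Edge p
      ... | old p′ = s-edge-∈cycle⁻ p′ b∈
      ... | new e  = proj₁ (NewEdge⇒∈cycle e)

  c∈cycle : c ∈ cycle
  c∈cycle = orbit⊆cycle (SameOrbit⇒∈orbit here)

  SameOrbit-t-c-New : ∀ q → q < K → SameOrbit t c (f q)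
  SameOrbit-t-c-New zero    _         = SameOrbit-trans (SameOrbit-mono s⊆t (∈orbit⇒SameOrbit last∈orbit)) (fwd enter∈t here)
  SameOrbit-t-c-New (suc q) (s≤s q<k) = SameOrbit-trans (SameOrbit-t-c-New q (m≤n⇒m≤1+n q<k)) (fwd (along∈t q<k) here)

  ∈cycle⇒SameOrbit : ∀ {m} → m ∈ cycle → SameOrbit t c m
  ∈cycle⇒SameOrbit m∈ with ∈cycle⁻ m∈
  ... | inj₁ m∈orbit         = SameOrbit-mono s⊆t (∈orbit⇒SameOrbit m∈orbit)
  ... | inj₂ (q , q<K , refl) = SameOrbit-t-c-New q q<K

  cycle-closed : ClosedAt t c
  cycle-closed m c~m with ∈cycle⁻ (SameOrbit-t-∈cycle c~m c∈cycle)
  ... | inj₁ m∈orbit = dom , ran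
    where
      dom : InDom t m
      dom with m ≟ last
      ... | yes refl   = f 0 , enter∈t
      ... | no m≢last  = let (y , p) = ∈orbit⇒InDom m∈orbit m≢last in y , s⊆t _ p
      ran : InRan t m
      ran with m ≟ first
      ... | yes refl   = f k , leave∈t
      ... | no m≢first = let (y , p) = ∈orbit⇒InRan m∈orbit m≢first in y , s⊆t _ p
  ... | inj₂ (q , q<K , refl) = dom q q<K , ran q q<K
    where
      dom : ∀ q → q < K → InDom t (f q)
      dom q q<K with q ≟ k
      ... | yes refl = first , leave∈t
      ... | no q≢k   = f (suc q) , along∈t (≤∧≢⇒< (≤-pred q<K) q≢k)
      ran : ∀ q → q < K → InRan t (f q)
      ran zero    _         = last , enter∈t
      ran (suc q) (s≤s q<k) = f q , along∈t q<k

  cycle-min : (∀ {j} → SameOrbit s c j → c ≤ j) → IsMinOrbit t c c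
  cycle-min c-min = here , λ j c~j → ≤-cycle (∈cycle⁻ (SameOrbit-t-∈cycle c~j c∈cycle))
    where
      ≤-cycle : ∀ {j} → j ∈ orbit ⊎ New j → c ≤ j
      ≤-cycle (inj₁ j∈orbit) = c-min (∈orbit⇒SameOrbit j∈orbit)
      ≤-cycle (inj₂ j-new)   = <⇒≤ (<-≤-trans c<B (New⇒B≤ j-new))

  cycle-size : OrbitSize t c (length cycle)
  cycle-size = cycle , cycle-unique , refl , λ m → ∈cycle⇒SameOrbit , λ c~m → SameOrbit-t-∈cycle c~m c∈cycle

  SameOrbit-t-∉cycle : ∀ {a m} → a ∉ cycle → SameOrbit t a m → SameOrbit s a m × m ∉ cycle
  SameOrbit-t-∉cycle a∉ here = here , a∉
  SameOrbit-t-∉cycle a∉ (fwd p a~m) with ∈t⇒Edge p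
  ... | new e  = ⊥-elim (a∉ (proj₁ (NewEdge⇒∈cycle e)))
  ... | old p′ = let (b~m , m∉) = SameOrbit-t-∉cycle (λ b∈ → a∉ (s-edge-∈cycle⁻ p′ b∈)) a~m in fwd p′ b~m , m∉
  SameOrbit-t-∉cycle a∉ (bwd p a~m) with ∈t⇒Edge p
  ... | new e  = ⊥-elim (a∉ (proj₂ (NewEdge⇒∈cycle e)))
  ... | old p′ = let (b~m , m∉) = SameOrbit-t-∉cycle (λ b∈ → a∉ (s-edge-∈cycle⁺ p′ b∈)) a~m in bwd p′ b~m , m∉

  SameOrbit-t⇒s : ∀ {a m} → a ∉ cycle → SameOrbit t a m → SameOrbit s a m
  SameOrbit-t⇒s a∉ a~m = proj₁ (SameOrbit-t-∉cycle a∉ a~m)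

  ClosedAt-s⇒t : ∀ {a} → a ∉ cycle → ClosedAt s a → ClosedAt t a
  ClosedAt-s⇒t a∉ closed m a~m =
    let ((y , my) , (y′ , y′m)) = closed m (SameOrbit-t⇒s a∉ a~m) in (y , s⊆t _ my) , (y′ , s⊆t _ y′m)

  ClosedAt-t⇒s : ∀ {a} → a ∉ cycle → ClosedAt t a → ClosedAt s a
  ClosedAt-t⇒s a∉ closed m a~m with SameOrbit-t-∉cycle a∉ (SameOrbit-mono s⊆t a~m) | closed m (SameOrbit-mono s⊆t a~m)
  ... | _ , m∉ | (y , my) , (y′ , y′m) = dom (∈t⇒Edge my) , ran (∈t⇒Edge y′m)
    where
      dom : Edge m y → InDom s m
      dom (old p) = y , p
      dom (new e) = ⊥-elim (m∉ (proj₁ (NewEdge⇒∈cycle e)))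
      ran : Edge y′ m → InRan s m
      ran (old p) = y′ , p
      ran (new e) = ⊥-elim (m∉ (proj₂ (NewEdge⇒∈cycle e)))

  -- The second alternative of new→new is a run that left the chain through first and re-entered it
  -- from last, which takes more than K steps.
  data Run (j y z : ℕ) : Set where
    old→old : ¬ New y → Walk s j y z → ¬ New z → Run j y z
    old→new : ¬ New y → ∀ p → p < K → z ≡ f p → p < j → Run j y z
    new→new : ∀ q → q < K → y ≡ f q → ∀ p → p < K → z ≡ f p → p ≡ q + j ⊎ p + suc K ≤ q + j → Run j y z
    new→old : ∀ q → q < K → y ≡ f q → ¬ New z → K ≤ q + j → Run j y z

  run-step : ∀ {j y u z} → j < K → Run j y u → Edge u z → Run (suc j) y z
  run-step _ (old→old y∉ w _) (old p) = old→old y∉ (walk-∷ʳ w p) (proj₂ (s-edge⇒¬New p))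
  run-step _ (old→old y∉ _ _) (new (enter _ refl)) = old→new y∉ 0 (s≤s z≤n) refl (s≤s z≤n)
  run-step _ (old→old _ _ u∉) (new (leave refl _)) = ⊥-elim (u∉ (k , ≤-refl , refl))
  run-step _ (old→old _ _ u∉) (new (along q q<k refl _)) = ⊥-elim (u∉ (q , m≤n⇒m≤1+n q<k , refl))
  run-step _ (old→new _ p p<K refl _) (old e) = ⊥-elim (proj₁ (s-edge⇒¬New e) (p , p<K , refl))
  run-step _ (old→new _ p _ refl _) (new (enter u≡ _)) = ⊥-elim (<B⇒≢f p last<B (sym u≡))
  run-step j<K (old→new _ p _ refl p<j) (new (leave u≡ _)) with f-injective u≡
  ... | refl = ⊥-elim (<-irrefl refl (<-≤-trans p<j (≤-pred j<K)))
  run-step _ (old→new y∉ p _ refl p<j) (new (along q q<k u≡ refl)) with f-injective u≡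
  ... | refl = old→new y∉ (suc p) (s≤s q<k) refl (s≤s p<j)
  run-step _ (new→new _ _ _ p p<K refl _) (old e) = ⊥-elim (proj₁ (s-edge⇒¬New e) (p , p<K , refl))
  run-step _ (new→new _ _ _ p _ refl _) (new (enter u≡ _)) = ⊥-elim (<B⇒≢f p last<B (sym u≡))
  run-step {j} j<K (new→new q q<K y≡ p _ refl stay∨wrap) (new (leave u≡ refl)) with f-injective u≡ | stay∨wrap
  ... | refl | inj₁ k≡q+j = new→old q q<K y≡ (<B⇒¬New first<B) (≤-reflexive (trans (cong suc k≡q+j) (sym (+-suc q j))))
  ... | refl | inj₂ wrap  = ⊥-elim (<⇒≱ (≤-<-trans (+-mono-≤ (≤-pred q<K) (≤-pred j<K)) (+-monoʳ-< k (m≤n⇒m≤1+n (n<1+n k)))) wrap)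
  run-step {j} _ (new→new q q<K y≡ p _ refl stay∨wrap) (new (along _ q′<k u≡ refl)) with f-injective u≡
  ... | refl = new→new q q<K y≡ (suc p) (s≤s q′<k) refl (⊎-map stay wrap stay∨wrap)
    where
      stay : p ≡ q + j → suc p ≡ q + suc j
      stay p≡q+j = trans (cong suc p≡q+j) (sym (+-suc q j))
      wrap : p + suc K ≤ q + j → suc p + suc K ≤ q + suc j
      wrap le = subst (suc p + suc K ≤_) (sym (+-suc q j)) (s≤s le)
  run-step {j} _ (new→old q q<K y≡ _ K≤) (old e) = new→old q q<K y≡ (proj₂ (s-edge⇒¬New e)) (≤-trans K≤ (+-monoʳ-≤ q (n≤1+n j)))
  run-step {j} _ (new→old q q<K y≡ _ K≤) (new (enter _ refl)) =
    new→new q q<K y≡ 0 (s≤s z≤n) refl (inj₂ (subst (suc K ≤_) (sym (+-suc q j)) (s≤s K≤)))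
  run-step _ (new→old _ _ _ u∉ _) (new (leave refl _)) = ⊥-elim (u∉ (k , ≤-refl , refl))
  run-step _ (new→old _ _ _ u∉ _) (new (along q q<k refl _)) = ⊥-elim (u∉ (q , m≤n⇒m≤1+n q<k , refl))

  run-shape : ∀ j {y z} → j ≤ K → Walk t j y z → Run j y z
  run-shape zero {y} _ [] with New? y
  ... | inj₁ (q , q<K , refl) = new→new q q<K refl q q<K refl (inj₁ (sym (+-identityʳ q)))
  ... | inj₂ y∉             = old→old y∉ [] y∉
  run-shape (suc j) j<K w with walk-unsnoc w
  ... | _ , w′ , p = run-step j<K (run-shape j (<⇒≤ j<K) w′) (∈t⇒Edge p)

  InField : ℕ → Set
  InField y = y < B ⊎ New y

  Outside : ℕ → Set
  Outside z = B ≤ z × ¬ New z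

  Outside⇒¬InField : ∀ {z} → Outside z → ¬ InField z
  Outside⇒¬InField (B≤z , _)  (inj₁ z<B) = <⇒≱ z<B B≤z
  Outside⇒¬InField (_ , z∉) (inj₂ z-new) = z∉ z-new

  Edge⇒InField : ∀ {a b} → Edge a b → InField a × InField b
  Edge⇒InField (old p)                     = inj₁ (proj₁ (s<B p)) , inj₁ (proj₂ (s<B p))
  Edge⇒InField (new (enter refl refl))     = inj₁ last<B , inj₂ (0 , s≤s z≤n , refl)
  Edge⇒InField (new (leave refl refl))     = inj₂ (k , ≤-refl , refl) , inj₁ first<B
  Edge⇒InField (new (along q q<k refl refl)) = inj₂ (q , m≤n⇒m≤1+n q<k , refl) , inj₂ (suc q , s≤s q<k , refl)

  walk-ends-InField : ∀ {j v u} → Walk t (suc j) v u → InField v × InField u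
  walk-ends-InField w@(p ∷ _) =
    proj₁ (Edge⇒InField (∈t⇒Edge p)) , proj₂ (Edge⇒InField (∈t⇒Edge (proj₂ (proj₂ (walk-unsnoc w)))))

  XWalk-ends-InField : ∀ e {v u} → e ≢ 0ℤ → XWalk t e v u → InField v × InField u
  XWalk-ends-InField (+ zero)    e≢0 _ = ⊥-elim (e≢0 refl)
  XWalk-ends-InField (+ suc j)   _   w = walk-ends-InField w
  XWalk-ends-InField -[1+ j ]    _   w = swap (walk-ends-InField w)

  power-run : ∀ e {v u} → e ≢ 0ℤ → ∣ e ∣ ≤ K → ¬ New v → XWalk t e v u → XWalk s e v u ⊎ New u
  power-run (+ zero) e≢0 _ _ _ = ⊥-elim (e≢0 refl)
  power-run (+ suc j) _ j<K v∉ w with run-shape (suc j) j<K w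
  ... | old→old _ w-s _      = inj₁ w-s
  ... | old→new _ p p<K u≡ _ = inj₂ (p , p<K , u≡)
  ... | new→new q q<K v≡ _ _ _ _ = ⊥-elim (v∉ (q , q<K , v≡))
  ... | new→old q q<K v≡ _ _     = ⊥-elim (v∉ (q , q<K , v≡))
  power-run -[1+ j ] _ j<K v∉ w with run-shape (suc j) j<K w
  ... | old→old _ w-s _           = inj₁ w-s
  ... | old→new _ p p<K v≡ _      = ⊥-elim (v∉ (p , p<K , v≡))
  ... | new→new _ _ _ p p<K v≡ _  = ⊥-elim (v∉ (p , p<K , v≡))
  ... | new→old q q<K u≡ _ _      = inj₂ (q , q<K , u≡)

  record Good (g : Perm) : Set where
    field
      <B↦¬New   : ∀ {y} → y < B → ¬ New (fun g y)
      f↦Outside : ∀ q → Outside (fun g (f q))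

  InField↦¬New : ∀ {g y} → Good g → InField y → ¬ New (fun g y)
  InField↦¬New good (inj₁ y<B)             = Good.<B↦¬New good y<B
  InField↦¬New good (inj₂ (q , _ , refl)) = proj₂ (Good.f↦Outside good q)

  New↦Outside : ∀ {g y} → Good g → New y → Outside (fun g y)
  New↦Outside good (q , _ , refl) = Good.f↦Outside good q

  GoodBlock : Perm × ℤ → Set
  GoodBlock (g , e) = Good g × e ≢ 0ℤ × ∣ e ∣ ≤ K

  -- Whatever leaves the chain through a generator lands outside the field of t, where it is stuck.
  Sound : Word → Set
  Sound v = ∀ {n m} → ¬ New n → Eval v t n m → (Eval v s n m × ¬ New m) ⊎ Outside m

  []-sound : Sound []
  []-sound n∉ refl = inj₁ (refl , n∉)

  block-sound : ∀ {b v} → GoodBlock b → Sound v → Sound (block b ++ v)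
  block-sound {g , e} (good , e≢0 , e≤K) v-sound n∉ (u , ev , refl) with Eval-++⁻ (xpow e) ev
  ... | k , ev-v , ev-e with XWalk-ends-InField e e≢0 (Eval-xpow⇒XWalk e ev-e) | v-sound n∉ ev-v
  ...   | k∈ , _  | inj₂ k-outside = ⊥-elim (Outside⇒¬InField k-outside k∈)
  ...   | _ , u∈ | inj₁ (ev-v-s , k∉) with power-run e e≢0 e≤K k∉ (Eval-xpow⇒XWalk e ev-e)
  ...     | inj₁ w-s   = inj₁ ((u , Eval-++⁺ (xpow e) ev-v-s (XWalk⇒Eval-xpow e w-s) , refl) , InField↦¬New good u∈)
  ...     | inj₂ u-new = inj₂ (New↦Outside good u-new)

  block-sound′ : ∀ {b} → GoodBlock b → Sound (block b)
  block-sound′ {b} gb = subst Sound (++-identityʳ (block b)) (block-sound gb []-sound)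

  blocks-sound : ∀ {bs v} → All GoodBlock bs → Sound v → Sound (concatMap block bs ++ v)
  blocks-sound []                         v-sound = v-sound
  blocks-sound {b ∷ bs} {v} (gb ∷ gbs) v-sound =
    subst Sound (sym (++-assoc (block b) (concatMap block bs) v)) (block-sound gb (blocks-sound gbs v-sound))

  block-output-¬New : ∀ {b v n m} → GoodBlock b → Eval (block b ++ v) t n m → ¬ New m
  block-output-¬New {_ , e} (good , e≢0 , _) (_ , ev , refl) with Eval-++⁻ (xpow e) ev
  ... | _ , _ , ev-e = InField↦¬New good (proj₂ (XWalk-ends-InField e e≢0 (Eval-xpow⇒XWalk e ev-e)))

  blocks-output-¬New : ∀ {bs b n m} → All GoodBlock bs → GoodBlock b
    → Eval (concatMap block bs ++ block b) t n m → ¬ New m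
  blocks-output-¬New {[]}     {b} {n} {m} []        gb ev =
    block-output-¬New gb (subst (λ w → Eval w t n m) (sym (++-identityʳ (block b))) ev)
  blocks-output-¬New {b′ ∷ bs} {b} {n} {m} (gb′ ∷ _) _  ev =
    block-output-¬New gb′ (subst (λ w → Eval w t n m) (++-assoc (block b′) (concatMap block bs) (block b)) ev)

  blocks-fix : ∀ {bs g₀ k₀ n} → All GoodBlock bs → GoodBlock (g₀ , + suc k₀)
    → Fix (concatMap block bs ++ block (g₀ , + suc k₀)) t n → Fix (concatMap block bs ++ block (g₀ , + suc k₀)) s n
  blocks-fix {bs} {k₀ = k₀} gbs gb₀ ev with blocks-sound gbs (block-sound′ gb₀) (blocks-output-¬New gbs gb₀ ev) ev
  ... | inj₁ (ev-s , _) = ev-s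
  ... | inj₂ n-outside with Eval-++⁻ (concatMap block bs) ev
  ...   | _ , (_ , ev-x , _) , _ =
          ⊥-elim (Outside⇒¬InField n-outside (proj₁ (walk-ends-InField (Eval-xʲ⇒Walk (suc k₀) ev-x))))

  -- A fixed point on the chain would have to travel around the whole new cycle, which takes more than K steps.
  power-fix : ∀ {j n} → suc j ≤ K → Fix (replicate (suc j) x) t n → Fix (replicate (suc j) x) s n
  power-fix {j} j<K ev with run-shape (suc j) j<K (Eval-xʲ⇒Walk (suc j) ev)
  ... | old→old _ w-s _            = Walk⇒Eval-xʲ w-s
  ... | old→new n∉ p p<K n≡ _     = ⊥-elim (n∉ (p , p<K , n≡))
  ... | new→old q q<K n≡ n∉ _     = ⊥-elim (n∉ (q , q<K , n≡))
  ... | new→new q _ refl p _ fq≡fp stay∨wrap with f-injective fq≡fp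
  ...   | refl = ⊥-elim ([ (λ q≡q+1+j → m≢1+m+n q (trans q≡q+1+j (+-suc q j)))
                         , <⇒≱ (+-monoʳ-< q (s≤s j<K)) ]′ stay∨wrap)

  nice-fix : ∀ {G w n} (p : IsNice G w) → (∀ {g} → g ∈ nice-perms G p → Good g) → nice-weight G p < K
    → Fix w t n → Fix w s n
  nice-fix (inj₁ (j , refl)) _ j<K = power-fix (<⇒≤ j<K)
  nice-fix {G} (inj₂ (bs , g₀ , k₀ , bs-ok , _ , _ , refl)) good weight<K =
    blocks-fix (blocks-good bs-ok (good ∘ there) (≤-trans (m≤n+m _ (suc k₀)) (<⇒≤ weight<K)))
               (good (here refl) , (λ ()) , ≤-trans (m≤m+n (suc k₀) _) (<⇒≤ weight<K))
    where
      blocks-good : ∀ {bs} → All (NiceBlock G) bs → (∀ {g} → g ∈ map proj₁ bs → Good g)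
        → sum (map (λ b → ∣ proj₂ b ∣) bs) ≤ K → All GoodBlock bs
      blocks-good []                     _    _   = []
      blocks-good {(_ , e) ∷ _} ((_ , _ , e≢0) ∷ ok) good Σ≤K =
        (good (here refl) , e≢0 , ≤-trans (m≤m+n ∣ e ∣ _) Σ≤K)
        ∷ blocks-good ok (good ∘ there) (≤-trans (m≤n+m _ ∣ e ∣) Σ≤K)

  IsMinOrbit-s⇒t : ∀ {n k} → n ∉ cycle → IsMinOrbit s n k → IsMinOrbit t n k
  IsMinOrbit-s⇒t n∉ (n~k , k-min) = SameOrbit-mono s⊆t n~k , λ j n~j → k-min j (SameOrbit-t⇒s n∉ n~j)

  closed-points-t : ∀ {l} → ClosedPoints s l → ClosedPoints t (l ++ cycle)
  closed-points-t {l} closed-points {m} with m ∈? cycle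
  ... | yes m∈cycle = (λ _ → ClosedAt-resp (∈cycle⇒SameOrbit m∈cycle) cycle-closed) , (λ _ → ∈-++⁺ʳ l m∈cycle)
  ... | no m∉cycle  = ⇒closed , ⇒∈
    where
      ⇒closed : m ∈ l ++ cycle → ClosedAt t m
      ⇒closed m∈ with ∈-++⁻ l m∈
      ... | inj₁ m∈l     = ClosedAt-s⇒t m∉cycle (proj₁ closed-points m∈l)
      ... | inj₂ m∈cycle = ⊥-elim (m∉cycle m∈cycle)
      ⇒∈ : ClosedAt t m → m ∈ l ++ cycle
      ⇒∈ closed = ∈-++⁺ˡ (proj₂ closed-points (ClosedAt-t⇒s m∉cycle closed))

  module _ (c-least : LeastOpen s c) where

    ClosedAt-s⇒∉cycle : ∀ {m} → ClosedAt s m → m ∉ cycle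
    ClosedAt-s⇒∉cycle {m} closed m∈ with ∈cycle⁻ m∈
    ... | inj₁ m∈orbit = proj₁ c-least (ClosedAt-resp (SameOrbit-sym (∈orbit⇒SameOrbit m∈orbit)) closed)
    ... | inj₂ m-new   = <B⇒¬New (proj₁ (s<B (proj₂ (proj₁ (closed m here))))) m-new

    c-cycle-min : IsMinOrbit t c c
    c-cycle-min = cycle-min (LeastOpen⇒orbit-min c-least)

    t-nice : ∀ {l} → ClosedPoints s l → NiceS s → NiceS t
    t-nice {l} closed-points s-nice n n-closed with least-open (closed-points-t closed-points)
    ... | c′ , c′-least = result
      where
        c<c′ : c < c′
        c<c′ = ≤∧≢⇒< (≮⇒≥ λ c′<c → proj₁ c′-least (proj₁ (closed-points-t closed-points) (∈-++⁺ˡ (proj₂ closed-points (proj₂ c-least c′<c)))))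
                     λ { refl → proj₁ c′-least cycle-closed }
        result : Σ ℕ λ k → IsMinOrbit t n k
                   × Σ ℕ λ c → (¬ ClosedAt t c × (∀ m → ¬ ClosedAt t m → c ≤ m)) × k < c
        result with n ∈? cycle
        ... | yes n∈cycle =
              c , (SameOrbit-sym (∈cycle⇒SameOrbit n∈cycle) , λ j n~j → proj₂ c-cycle-min j (SameOrbit-trans (∈cycle⇒SameOrbit n∈cycle) n~j))
                , c′ , (proj₁ c′-least , λ _ → LeastOpen⇒≤ c′-least) , c<c′
        ... | no n∉cycle with s-nice n (ClosedAt-t⇒s n∉cycle n-closed)
        ...   | k , k-min , c″ , (_ , c″-least) , k<c″ =
              k , IsMinOrbit-s⇒t n∉cycle k-min
                , c′ , (proj₁ c′-least , λ _ → LeastOpen⇒≤ c′-least)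
                , <-≤-trans k<c″ (≤-trans (c″-least c (proj₁ c-least)) (<⇒≤ c<c′))

    t-enum : ∀ {reps} → NiceS s → ClosedOrbitEnum s reps → ClosedOrbitEnum t (reps ++ [ c ])
    t-enum {reps} s-nice (reps-ok , reps-linked , complete) =
      All.++⁺ (All.map old-rep reps-ok) ((cycle-closed , c-cycle-min) ∷ []) ,
      linked-∷ʳ reps-linked (All.map (λ (closed , n-min) → NiceS⇒rep<open s-nice closed n-min (proj₁ c-least)) reps-ok) ,
      complete-t
      where
        old-rep : ∀ {n} → ClosedAt s n × IsMinOrbit s n n → ClosedAt t n × IsMinOrbit t n n
        old-rep (closed , n-min) = ClosedAt-s⇒t (ClosedAt-s⇒∉cycle closed) closed , IsMinOrbit-s⇒t (ClosedAt-s⇒∉cycle closed) n-min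
        complete-t : ∀ n → ClosedAt t n → Σ ℕ λ m → m ∈ reps ++ [ c ] × SameOrbit t n m
        complete-t n closed with n ∈? cycle
        ... | yes n∈cycle = c , ∈-++⁺ʳ reps (here refl) , SameOrbit-sym (∈cycle⇒SameOrbit n∈cycle)
        ... | no n∉cycle  = let (m , m∈ , n~m) = complete n (ClosedAt-t⇒s n∉cycle closed)
                            in m , ∈-++⁺ˡ m∈ , SameOrbit-mono s⊆t n~m

    t-codes : ∀ {r} → NiceS s → (s-codes : Codes s r) → length cycle % 2 ≡ bit (r (length (proj₁ s-codes))) → Codes t r
    t-codes {r} s-nice (reps , enum , sizes) parity = reps ++ [ c ] , t-enum s-nice enum , sizes-t
      where
        old-size : ∀ {n k} → ClosedAt s n → OrbitSize s n k → OrbitSize t n k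
        old-size closed (l , l-unique , l-length , l-orbit) =
          l , l-unique , l-length , λ m → (λ m∈l → SameOrbit-mono s⊆t (proj₁ (l-orbit m) m∈l))
                                       , (λ n~m → proj₂ (l-orbit m) (SameOrbit-t⇒s (ClosedAt-s⇒∉cycle closed) n~m))
        sizes-t : ∀ i → Σ ℕ λ k → OrbitSize t (lookup (reps ++ [ c ]) i) k × k % 2 ≡ bit (r (toℕ i))
        sizes-t i with lookup-∷ʳ reps c i
        ... | inj₂ (i≡n , eq) =
                length cycle , subst (λ v → OrbitSize t v _) (sym eq) cycle-size , trans parity (cong (bit ∘ r) (sym i≡n))
        ... | inj₁ (j , i≡j , eq) with sizes j
        ...   | k , size , k-parity =
                k , subst (λ v → OrbitSize t v k) (sym eq) (old-size (proj₁ (All.lookup (proj₁ enum) (∈-lookup j))) size)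
                  , trans k-parity (cong (bit ∘ r) (sym i≡j))

module Extension (G : CofinitaryGroup) (r : ℕ → Bool) {s : PInj} {E : List Word}
                 (E-nice : InZ G s E) (s-nice : NiceS s) (s-codes : Codes s r) where

  reps : List ℕ
  reps = proj₁ s-codes

  c : ℕ
  c = proj₁ (least-open (proj₂ (Codes⇒ClosedPoints {r = r} s-codes)))

  c-least : LeastOpen s c
  c-least = proj₂ (least-open (proj₂ (Codes⇒ClosedPoints {r = r} s-codes)))

  O : OpenOrbit s c
  O = open-orbit (proj₁ c-least)

  s-points : List ℕ
  s-points = c ∷ map proj₁ (pairs s) ++ map proj₂ (pairs s)

  B : ℕ
  B = suc (sum s-points)

  s<B : ∀ {a b} → (a , b) ∈ pairs s → a < B × b < B
  s<B p = s≤s (∈⇒≤sum (there (∈-++⁺ˡ (∈-map⁺ proj₁ p))))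
        , s≤s (∈⇒≤sum (there (∈-++⁺ʳ (map proj₁ (pairs s)) (∈-map⁺ proj₂ p))))

  c<B : c < B
  c<B = s≤s (∈⇒≤sum {l = s-points} (here refl))

  gs : List Perm
  gs = words-perms G E-nice

  D : ℕ
  D = words-weight G E-nice

  b : ℕ
  b = bit (r (length reps))

  L : ℕ
  L = length (OpenOrbit.orbit O)

  -- K = suc k = b + L + 2 (D + 1) exceeds the total exponent D of E, and the new cycle has L + K ≡ b (mod 2) points.
  k : ℕ
  k = suc (D + D + L + b)

  open FreshChain gs (proj₁ (common-fixed-bound (words-perms-cofinitary G E-nice)))
                     (proj₂ (common-fixed-bound (words-perms-cofinitary G E-nice))) B
  open ClosingChain O B s<B c<B f f-mono B≤f k public

  good : ∀ {g} → g ∈ gs → Good g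
  good g∈ = record
    { <B↦¬New   = λ y<B (q , _ , eq) → <-irrefl eq (fun<f q g∈ y<B)
    ; f↦Outside = λ q → B≤fun-f q g∈ , λ (p , _ , eq) → fun-f≢f q p g∈ eq
    }

  D<K : D < K
  D<K = s≤s (m≤n⇒m≤1+n (≤-trans (m≤m+n D D) (≤-trans (m≤m+n _ L) (m≤m+n _ b))))

  t≤s : Leq t E s E
  t≤s = s⊆t , (λ _ w∈ → w∈) , λ w w∈ n → fix⇒ w∈ , Eval-mono s⊆t w
    where
      fix⇒ : ∀ {w n} → w ∈ E → Fix w t n → Fix w s n
      fix⇒ w∈ = let (p , ⊆gs , ≤D) = word-bounds G E-nice w∈ in nice-fix p (good ∘ ⊆gs) (≤-<-trans ≤D D<K)

  cycle-parity : length cycle % 2 ≡ b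
  cycle-parity = begin
    length cycle % 2                   ≡⟨ cong (_% 2) (length-++ (OpenOrbit.orbit O)) ⟩
    (L + length (map f (upTo K))) % 2  ≡⟨ cong (λ n → (L + n) % 2) (trans (length-map f (upTo K)) (length-upTo K)) ⟩
    (L + K) % 2                        ≡⟨ cong (_% 2) (regroup L D b) ⟩
    (b + (L + D + 1) * 2) % 2          ≡⟨ bit-parity (r (length reps)) (L + D + 1) ⟩
    b                                  ∎
    where
      open ≡-Reasoning
      regroup : ∀ L D b → L + suc (suc (D + D + L + b)) ≡ b + (L + D + 1) * 2
      regroup = solve-∀

  t-in-Zr : InZr G r t E
  t-in-Zr = E-nice , t-nice c-least (proj₂ (Codes⇒ClosedPoints {r = r} s-codes)) s-nice , t-codes c-least {r} s-nice s-codes cycle-parity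

  s-count : ClosedOrbitCount s (length reps)
  s-count = reps , proj₁ (proj₂ s-codes) , refl

  t-count : ClosedOrbitCount t (length (reps ++ [ c ]))
  t-count = reps ++ [ c ] , t-enum c-least s-nice (proj₁ (proj₂ s-codes)) , refl

  more-closed-orbits : length reps < length (reps ++ [ c ])
  more-closed-orbits = ≤-reflexive (trans (+-comm 1 (length reps)) (sym (length-++ reps)))

corollary4p8 : (G : CofinitaryGroup) (r : ℕ → Bool) (s : PInj) (E : List Word)
    → InZr G r s E
    → Σ PInj λ t → InZr G r t E × Leq t E s E
        × Σ ℕ λ a → Σ ℕ λ b → ClosedOrbitCount s a × ClosedOrbitCount t b × a < b
corollary4p8 G r s E (E-nice , s-nice , s-codes) =
  t , t-in-Zr , t≤s , length reps , length (reps ++ [ c ]) , s-count , t-count , more-closed-orbits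
  where open Extension G r E-nice s-nice s-codes
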